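{- Let $v\in\mathbb{N}$ and let $a_1,\dots,a_m$ be distinct divisors of $v$ such that $\operatorname{lcm}(a_i,a_j)=v$ for all $i\ne j$. For $1\le i\le m$ define the binary sequence $X_i=(x_t)_{t=0}^{v-1}$ by $x_t=1$ if $t=la_i$ for some $0\le l\le\frac{v}{a_i}-1$, and $x_t=0$ otherwise. Then $\{X_1,\dots,X_m\}$ is a $(v,W,\Lambda,\lambda_c,R)$-VW-OOC with $N=m$ codewords, where $W=\{w_1,\dots,w_m\}$ with $w_i=\frac{v}{a_i}$, $r_i=\frac1m$ for each $i$, $\lambda_a(i)=\frac{v}{a_i}$, and $\lambda_c=1$.
   Context: Indices of sequences of length $v$ are taken modulo $v$. Let $\mathcal{C}=\{C_a:0\le a\le N-1\}$ be a set of $N$ binary sequences of length $v$, $C_a=(c_a(t))_{t=0}^{v-1}$. The autocorrelation of $C_a$ at shift $\delta$ ($1\le\delta\le v-1$) is $\sum_{t=0}^{v-1}c_a(t)c_a(t+\delta)$, and the cross-correlation of $C_a,C_b$ at shift $\delta$ ($0\le\delta\le v-1$) is $\sum_{t=0}^{v-1}c_a(t)c_b(t+\delta)$. Then $\mathcal{C}$ is a $(v,W,\Lambda,\lambda_c,R)$-VW-OOC with $W=\{w_1,\dots,w_m\}$, $\Lambda=\{\lambda_a(1),\dots,\lambda_a(m)\}$, $R=\{r_1,\dots,r_m\}$ if: (i) exactly $r_iN$ codewords have weight $w_i$ for $1\le i\le m$, where $r_1+\dots+r_m=1$ and $r_j\ge 0$; (ii) the autocorrelation of every codeword of weight $w_i$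 is at most $\lambda_a(i)$ at all nonzero shifts; (iii) the cross-correlation between any two distinct codewords is at most $\lambda_c$ at all shifts. -}

module Defs where

open import Data.Nat using (ℕ; zero; suc; _+_; _*_; _<_; _≤_; _≡ᵇ_; NonZero)
open import Data.Nat.DivMod using (_/_; _%_; m%n<n)
open import Data.Bool using (Bool; true; false; if_then_else_)
open import Data.Fin using (Fin; toℕ; fromℕ<)
import Data.Fin
open import Data.List using (upTo)
open import Data.Bool.ListAction using (any)
open import Data.Integer using (+_)
open import Data.Rational using (ℚ; 0ℚ; 1ℚ) renaming (_+_ to _+ℚ_; _*_ to _*ℚ_; _≤_ to _≤ℚ_)
import Data.Rational as Q
open import Relation.Binary.PropositionalEquality using (_≡_; _≢_)

sumFin : (n : ℕ) → (Fin n → ℕ) → ℕ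
sumFin zero    f = 0
sumFin (suc n) f = f Data.Fin.zero + sumFin n (λ i → f (Data.Fin.suc i))

sumFinℚ : (n : ℕ) → (Fin n → ℚ) → ℚ
sumFinℚ zero    f = 0ℚ
sumFinℚ (suc n) f = f Data.Fin.zero +ℚ sumFinℚ n (λ i → f (Data.Fin.suc i))

ℕ→ℚ : ℕ → ℚ
ℕ→ℚ n = Q._/_ (+ n) 1

b2n : Bool → ℕ
b2n true  = 1
b2n false = 0

BinSeq : ℕ → Set
BinSeq v = Fin v → Bool

shiftIdx : (v : ℕ) .{{_ : NonZero v}} → Fin v → ℕ → Fin v
shiftIdx v t δ = fromℕ< (m%n<n (toℕ t + δ) v)

weight : ∀ {v} → BinSeq v → ℕ
weight {v} c = sumFin v (λ t → b2n (c t))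

corr : (v : ℕ) .{{_ : NonZero v}} → BinSeq v → BinSeq v → ℕ → ℕ
corr v c d δ = sumFin v (λ t → b2n (c t) * b2n (d (shiftIdx v t δ)))

-- (v, W, Λ, λc, R)-VW-OOC with N codewords C_0..C_{N-1},
-- W = (w_1..w_m), Λ = (λ_a(1)..λ_a(m)), R = (r_1..r_m)
record IsVWOOC (v : ℕ) .{{_ : NonZero v}} (N m : ℕ) (C : Fin N → BinSeq v)
               (W Λ : Fin m → ℕ) (λc : ℕ) (R : Fin m → ℚ) : Set where
  field
    r-nonneg   : ∀ i → 0ℚ ≤ℚ R i
    r-sum      : sumFinℚ m R ≡ 1ℚ
    weight-count : ∀ i →
      ℕ→ℚ (sumFin N (λ a → if weight (C a) ≡ᵇ W i then 1 else 0)) ≡ R i *ℚ ℕ→ℚ N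
    auto-bound : ∀ a i → weight (C a) ≡ W i →
      ∀ δ → 1 ≤ δ → δ < v → corr v (C a) (C a) δ ≤ Λ i
    cross-bound : ∀ a b → a ≢ b → ∀ δ → δ < v → corr v (C a) (C b) δ ≤ λc

-- total natural division (v / 0 := 0; only used with a ∣ v, v ≠ 0, so a ≠ 0)
_div_ : ℕ → ℕ → ℕ
m div zero    = 0
m div (suc n) = m / suc n

Xseq : (v a : ℕ) → BinSeq v
Xseq v a t = any (λ l → toℕ t ≡ᵇ l * a) (upTo (v div a))

{-# OPTIONS --safe #-}
module Submission where

-- X_a is the indicator of the multiples of a in ℤ_v, so it has v/a ones and its
-- autocorrelation is trivially bounded by its weight. A shift t of X_a against X_b
-- contributes to the cross-correlation at δ only if a ∣ t and b ∣ t + δ; two such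
-- t differ by a common multiple of a and b, that is by a multiple of lcm(a,b) = v,
-- so there is at most one. Finally a ↦ v/a is injective on divisors of v, so the m
-- weights are distinct and each occurs for exactly one codeword.

open import Defs
open import Algebra.Properties.CommutativeSemigroup using (xy∙z≈xz∙y)
open import Data.Bool using (Bool; true; false; T; _∧_; if_then_else_)
open import Data.Bool.Properties using (T-∧)
open import Data.Empty using (⊥-elim)
open import Data.Fin as Fin using (Fin; toℕ)
open import Data.Fin.Properties using (toℕ<n; toℕ-fromℕ<; toℕ-injective; any?)
  renaming (suc-injective to Fin-suc-injective)
open import Data.Integer as ℤ using (+_)
import Data.Integer.Properties as ℤ
open import Data.List using (upTo)
open import Data.List.Membership.Propositional using (lose)
open import Data.List.Membership.Propositional.Properties using (∈-upTo⁺)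
open import Data.List.Relation.Unary.Any using (satisfied)
open import Data.List.Relation.Unary.Any.Properties using (any⁺; any⁻)
open import Data.Nat using (ℕ; zero; suc; _+_; _*_; _≤_; _<_; _≡ᵇ_; z≤n; z<s; s<s; NonZero; ≢-nonZero⁻¹; >-nonZero)
open import Data.Nat.Coprimality using (1-coprimeTo) renaming (sym to coprime-sym)
open import Data.Nat.DivMod using (m/n*n≡m; m*[n/m]≡n; m≥n⇒m/n>0)
open import Data.Nat.Divisibility
  using (_∣_; _∣?_; divides; ∣-refl; _∣0; 0∣⇒≡0; ∣⇒≤; >⇒∤; ∣m∣n⇒∣m+n; ∣m+n∣m⇒∣n; ∣n∣m%n⇒∣m)
open import Data.Nat.LCM using (lcm; lcm-least)
open import Data.Nat.Properties
  using ( ≤-refl; ≤-reflexive; ≤-trans; ≤-<-trans; ≤-total; module ≤-Reasoning; +-assoc; +-identityʳ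
        ; +-mono-≤; m≤n+m; m≤n⇒∃[o]m+o≡n; *-cancelʳ-≡; *-cancelʳ-<; ≡ᵇ⇒≡; ≡⇒≡ᵇ; +-commutativeSemigroup)
open import Data.Product using (_×_; _,_; proj₁)
open import Data.Rational as ℚ using (ℚ; mkℚ; 1ℚ; 1/_; _/_)
import Data.Rational.Properties as ℚ
open import Data.Sum using (inj₁; inj₂)
open import Function using (_∘_; _⇔_; mk⇔; Equivalence)
open import Relation.Binary.PropositionalEquality
open import Relation.Nullary using (¬_; yes; no; does; contradiction)
open import Relation.Nullary.Decidable using (T?; does-⇔; dec-true; dec-false; decidable-stable)

count : (n : ℕ) → (Fin n → Bool) → ℕ
count n p = sumFin n (λ t → b2n (p t))

b2n-mono : ∀ {x y} → (T x → T y) → b2n x ≤ b2n y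
b2n-mono {false} _ = z≤n
b2n-mono {true} {true} _ = ≤-refl
b2n-mono {true} {false} x⇒y = ⊥-elim (x⇒y _)

b2n-∧ : ∀ x y → b2n x * b2n y ≡ b2n (x ∧ y)
b2n-∧ false _ = refl
b2n-∧ true y = +-identityʳ (b2n y)

if-1-0≡b2n : ∀ x → (if x then 1 else 0) ≡ b2n x
if-1-0≡b2n false = refl
if-1-0≡b2n true = refl

sumFin-cong : ∀ n {f g : Fin n → ℕ} → (∀ t → f t ≡ g t) → sumFin n f ≡ sumFin n g
sumFin-cong zero f≡g = refl
sumFin-cong (suc n) f≡g = cong₂ _+_ (f≡g Fin.zero) (sumFin-cong n (f≡g ∘ Fin.suc))

count-mono : ∀ n {p q : Fin n → Bool} → (∀ t → T (p t) → T (q t)) → count n p ≤ count n q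
count-mono zero p⇒q = z≤n
count-mono (suc n) p⇒q = +-mono-≤ (b2n-mono (p⇒q Fin.zero)) (count-mono n (p⇒q ∘ Fin.suc))

count-≡0 : ∀ n (p : Fin n → Bool) → (∀ t → ¬ T (p t)) → count n p ≡ 0
count-≡0 zero p none = refl
count-≡0 (suc n) p none with p Fin.zero in p0
... | true = ⊥-elim (none Fin.zero (subst T (sym p0) _))
... | false = count-≡0 n (p ∘ Fin.suc) (none ∘ Fin.suc)

count-≡1 : ∀ n (p : Fin n → Bool) i → T (p i) → (∀ t → T (p t) → t ≡ i) → count n p ≡ 1
count-≡1 (suc n) p Fin.zero pi only-i with p Fin.zero
... | true = cong suc (count-≡0 n (p ∘ Fin.suc) (λ t pt → contradiction (only-i (Fin.suc t) pt) λ ()))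
count-≡1 (suc n) p (Fin.suc i) pi only-i with p Fin.zero in p0
... | true = contradiction (only-i Fin.zero (subst T (sym p0) _)) λ ()
... | false = count-≡1 n (p ∘ Fin.suc) i pi (λ t pt → Fin-suc-injective (only-i (Fin.suc t) pt))

count-≤1 : ∀ n (p : Fin n → Bool) → (∀ t s → T (p t) → T (p s) → t ≡ s) → count n p ≤ 1
count-≤1 n p unique with any? (λ t → T? (p t))
... | yes (i , pi) = ≤-reflexive (count-≡1 n p i pi (λ t pt → unique t i pt pi))
... | no ∄i = ≤-trans (≤-reflexive (count-≡0 n p (λ t pt → ∄i (t , pt)))) z≤n

fibre-count : ∀ n (f : Fin n → ℕ) i {w} → f i ≡ w → (∀ j → f j ≡ w → j ≡ i) →
              sumFin n (λ j → if f j ≡ᵇ w then 1 else 0) ≡ 1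
fibre-count n f i fi≡w only-i = begin
  sumFin n (λ j → if f j ≡ᵇ _ then 1 else 0) ≡⟨ sumFin-cong n (λ j → if-1-0≡b2n (f j ≡ᵇ _)) ⟩
  count n (λ j → f j ≡ᵇ _)                   ≡⟨ count-≡1 n _ i (≡⇒≡ᵇ _ _ fi≡w) (λ j → only-i j ∘ ≡ᵇ⇒≡ _ _) ⟩
  1                                          ∎
  where open ≡-Reasoning

corr≡count-∧ : ∀ v .{{_ : NonZero v}} (c d : BinSeq v) δ →
               corr v c d δ ≡ count v (λ t → c t ∧ d (shiftIdx v t δ))
corr≡count-∧ v c d δ = sumFin-cong v (λ t → b2n-∧ (c t) (d (shiftIdx v t δ)))

corr≤weight : ∀ v .{{_ : NonZero v}} (c d : BinSeq v) δ → corr v c d δ ≤ weight c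
corr≤weight v c d δ = begin
  corr v c d δ                              ≡⟨ corr≡count-∧ v c d δ ⟩
  count v (λ t → c t ∧ d (shiftIdx v t δ)) ≤⟨ count-mono v (λ t → proj₁ ∘ Equivalence.to T-∧) ⟩
  weight c                                  ∎
  where open ≤-Reasoning

0∤ : ∀ {n} .{{_ : NonZero n}} → ¬ 0 ∣ n
0∤ {n} 0∣n = ≢-nonZero⁻¹ n (0∣⇒≡0 0∣n)

Xseq-divides : ∀ {v a} .{{_ : NonZero v}} → a ∣ v → (t : Fin v) → T (Xseq v a t) ⇔ a ∣ toℕ t
Xseq-divides {a = zero} 0∣v t = contradiction 0∣v 0∤
Xseq-divides {v} {a@(suc _)} a∣v t = mk⇔ to from
  where
  to : T (Xseq v a t) → a ∣ toℕ t
  to x with l , t≡la ← satisfied (any⁻ _ (upTo (v div a)) x) = divides l (≡ᵇ⇒≡ _ _ t≡la)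
  from : a ∣ toℕ t → T (Xseq v a t)
  from (divides l t≡la) = any⁺ _ (lose (∈-upTo⁺ l<v-div-a) (≡⇒≡ᵇ _ _ t≡la))
    where
    l<v-div-a : l < v div a
    l<v-div-a = *-cancelʳ-< a l (v div a) (begin-strict
      l * a     ≡⟨ t≡la ⟨
      toℕ t     <⟨ toℕ<n t ⟩
      v         ≡⟨ m/n*n≡m a∣v ⟨
      v div a * a ∎)
      where open ≤-Reasoning

Xseq≡does-∣? : ∀ {v a} .{{_ : NonZero v}} → a ∣ v → (t : Fin v) → Xseq v a t ≡ does (a ∣? toℕ t)
Xseq≡does-∣? a∣v t = does-⇔ (Xseq-divides a∣v t) (T? _) (_ ∣? _)

sumUpTo : ℕ → (ℕ → ℕ) → ℕ
sumUpTo zero f = 0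
sumUpTo (suc n) f = f 0 + sumUpTo n (f ∘ suc)

sumFin-toℕ : ∀ n (f : ℕ → ℕ) → sumFin n (f ∘ toℕ) ≡ sumUpTo n f
sumFin-toℕ zero f = refl
sumFin-toℕ (suc n) f = cong (_+_ (f 0)) (sumFin-toℕ n (f ∘ suc))

sumUpTo-cong : ∀ n {f g : ℕ → ℕ} → (∀ j → f j ≡ g j) → sumUpTo n f ≡ sumUpTo n g
sumUpTo-cong zero f≡g = refl
sumUpTo-cong (suc n) f≡g = cong₂ _+_ (f≡g 0) (sumUpTo-cong n (f≡g ∘ suc))

sumUpTo-≡0 : ∀ n (f : ℕ → ℕ) → (∀ j → j < n → f j ≡ 0) → sumUpTo n f ≡ 0
sumUpTo-≡0 zero f f≡0 = refl
sumUpTo-≡0 (suc n) f f≡0 = cong₂ _+_ (f≡0 0 z<s) (sumUpTo-≡0 n (f ∘ suc) (λ j → f≡0 (suc j) ∘ s<s))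

sumUpTo-+ : ∀ m n (f : ℕ → ℕ) → sumUpTo (m + n) f ≡ sumUpTo m f + sumUpTo n (f ∘ (_+_ m))
sumUpTo-+ zero n f = refl
sumUpTo-+ (suc m) n f = trans (cong (_+_ (f 0)) (sumUpTo-+ m n (f ∘ suc))) (sym (+-assoc (f 0) _ _))

multiples-below : ∀ a .{{_ : NonZero a}} q → sumUpTo (q * a) (λ j → b2n (does (a ∣? j))) ≡ q
multiples-below a zero = refl
multiples-below a@(suc a-1) (suc q) = begin
  sumUpTo (a + q * a) [a∣_]
    ≡⟨ sumUpTo-+ a (q * a) [a∣_] ⟩
  sumUpTo a [a∣_] + sumUpTo (q * a) ([a∣_] ∘ (_+_ a))
    ≡⟨ cong₂ _+_ one-per-block (sumUpTo-cong (q * a) periodic) ⟩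
  1 + sumUpTo (q * a) [a∣_]
    ≡⟨ cong suc (multiples-below a q) ⟩
  suc q ∎
  where
  open ≡-Reasoning
  [a∣_] : ℕ → ℕ
  [a∣ j ] = b2n (does (a ∣? j))
  periodic : ∀ j → [a∣ a + j ] ≡ [a∣ j ]
  periodic j = cong b2n (does-⇔ (mk⇔ (λ a∣a+j → ∣m+n∣m⇒∣n a∣a+j ∣-refl) (∣m∣n⇒∣m+n ∣-refl)) (a ∣? a + j) (a ∣? j))
  one-per-block : sumUpTo a [a∣_] ≡ 1
  one-per-block = cong₂ _+_ (cong b2n (dec-true (a ∣? 0) (a ∣0)))
    (sumUpTo-≡0 a-1 ([a∣_] ∘ suc) (λ j j<a-1 → cong b2n (dec-false (a ∣? suc j) (>⇒∤ (s<s j<a-1)))))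

weight-Xseq : ∀ {v a} .{{_ : NonZero v}} → a ∣ v → weight (Xseq v a) ≡ v div a
weight-Xseq {a = zero} 0∣v = contradiction 0∣v 0∤
weight-Xseq {v} {a@(suc _)} a∣v = begin
  sumFin v (λ t → b2n (Xseq v a t))                 ≡⟨ sumFin-cong v (cong b2n ∘ Xseq≡does-∣? a∣v) ⟩
  sumFin v (λ t → b2n (does (a ∣? toℕ t)))          ≡⟨ sumFin-toℕ v _ ⟩
  sumUpTo v (λ j → b2n (does (a ∣? j)))             ≡⟨ cong (λ n → sumUpTo n _) (m/n*n≡m a∣v) ⟨
  sumUpTo (v div a * a) (λ j → b2n (does (a ∣? j))) ≡⟨ multiples-below a (v div a) ⟩
  v div a                                           ∎
  where open ≡-Reasoning

div-injective : ∀ {v a b} .{{_ : NonZero v}} → a ∣ v → b ∣ v → v div a ≡ v div b → a ≡ b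
div-injective {a = zero} 0∣v _ _ = contradiction 0∣v 0∤
div-injective {b = zero} _ 0∣v _ = contradiction 0∣v 0∤
div-injective {v} {a@(suc _)} {b@(suc _)} a∣v b∣v v/a≡v/b = *-cancelʳ-≡ a b (v div a) (begin
  a * (v div a) ≡⟨ m*[n/m]≡n a∣v ⟩
  v             ≡⟨ m*[n/m]≡n b∣v ⟨
  b * (v div b) ≡⟨ cong (b *_) v/a≡v/b ⟨
  b * (v div a) ∎)
  where
  open ≡-Reasoning
  instance _ = >-nonZero (m≥n⇒m/n>0 (∣⇒≤ a∣v))

∣-<⇒≡0 : ∀ {m n} → m ∣ n → n < m → n ≡ 0
∣-<⇒≡0 {n = zero} _ _ = refl
∣-<⇒≡0 {n = suc _} m∣n n<m = contradiction m∣n (>⇒∤ n<m)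

lcm-separates-≤ : ∀ {A B δ x y} → x ≤ y → y < lcm A B →
                  A ∣ x → A ∣ y → B ∣ x + δ → B ∣ y + δ → x ≡ y
lcm-separates-≤ {A} {B} {δ} {x} {y} x≤y y<l A∣x A∣y B∣x+δ B∣y+δ
  with d , x+d≡y ← m≤n⇒∃[o]m+o≡n x≤y = begin
    x     ≡⟨ +-identityʳ x ⟨
    x + 0 ≡⟨ cong (_+_ x) d≡0 ⟨
    x + d ≡⟨ x+d≡y ⟩
    y     ∎
  where
  open ≡-Reasoning
  A∣d : A ∣ d
  A∣d = ∣m+n∣m⇒∣n (subst (A ∣_) (sym x+d≡y) A∣y) A∣x
  B∣d : B ∣ d
  B∣d = ∣m+n∣m⇒∣n (subst (B ∣_) y+δ≡x+δ+d B∣y+δ) B∣x+δ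
    where
    y+δ≡x+δ+d : y + δ ≡ x + δ + d
    y+δ≡x+δ+d = trans (cong (_+ δ) (sym x+d≡y)) (xy∙z≈xz∙y +-commutativeSemigroup x d δ)
  d≡0 : d ≡ 0
  d≡0 = ∣-<⇒≡0 (lcm-least A∣d B∣d) (≤-<-trans (subst (d ≤_) x+d≡y (m≤n+m d x)) y<l)

lcm-separates : ∀ {A B δ x y} → x < lcm A B → y < lcm A B →
                A ∣ x → A ∣ y → B ∣ x + δ → B ∣ y + δ → x ≡ y
lcm-separates x<l y<l A∣x A∣y B∣x+δ B∣y+δ with ≤-total _ _
... | inj₁ x≤y = lcm-separates-≤ x≤y y<l A∣x A∣y B∣x+δ B∣y+δ
... | inj₂ y≤x = sym (lcm-separates-≤ y≤x x<l A∣y A∣x B∣y+δ B∣x+δ)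

∣-shiftIdx : ∀ {v B} .{{_ : NonZero v}} → B ∣ v → ∀ t δ → B ∣ toℕ (shiftIdx v t δ) → B ∣ toℕ t + δ
∣-shiftIdx B∣v t δ B∣s = ∣n∣m%n⇒∣m B∣v (subst (_ ∣_) (toℕ-fromℕ< _) B∣s)

corr-Xseq-≤1 : ∀ {v A B} .{{_ : NonZero v}} → A ∣ v → B ∣ v → lcm A B ≡ v →
               ∀ δ → corr v (Xseq v A) (Xseq v B) δ ≤ 1
corr-Xseq-≤1 {v} {A} {B} A∣v B∣v l≡v δ = begin
  corr v (Xseq v A) (Xseq v B) δ ≡⟨ corr≡count-∧ v (Xseq v A) (Xseq v B) δ ⟩
  count v coincidence            ≤⟨ count-≤1 v coincidence unique ⟩
  1                              ∎
  where
  open ≤-Reasoning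
  coincidence : Fin v → Bool
  coincidence t = Xseq v A t ∧ Xseq v B (shiftIdx v t δ)
  divides-both : ∀ t → T (coincidence t) → A ∣ toℕ t × B ∣ toℕ t + δ
  divides-both t hit with XA , XB ← Equivalence.to T-∧ hit =
    Equivalence.to (Xseq-divides A∣v t) XA , ∣-shiftIdx B∣v t δ (Equivalence.to (Xseq-divides B∣v _) XB)
  below-lcm : ∀ (t : Fin v) → toℕ t < lcm A B
  below-lcm t = subst (toℕ t <_) (sym l≡v) (toℕ<n t)
  unique : ∀ t s → T (coincidence t) → T (coincidence s) → t ≡ s
  unique t s hit-t hit-s with A∣t , B∣t+δ ← divides-both t hit-t | A∣s , B∣s+δ ← divides-both s hit-s =
    toℕ-injective (lcm-separates (below-lcm t) (below-lcm s) A∣t A∣s B∣t+δ B∣s+δ)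

ℕ→ℚ≡mkℚ : ∀ n → ℕ→ℚ n ≡ mkℚ (+ n) 0 (coprime-sym (1-coprimeTo n))
ℕ→ℚ≡mkℚ n = ℚ.normalize-coprime (coprime-sym (1-coprimeTo n))

ℕ→ℚ-suc : ∀ n → ℕ→ℚ (suc n) ≡ 1ℚ ℚ.+ ℕ→ℚ n
-- 1ℚ + mkℚ (+ n) 0 _ unfolds to (+ 1 * + 1 + + n * + 1) / 1.
ℕ→ℚ-suc n = trans (cong (λ i → i / 1) numerator) (cong (1ℚ ℚ.+_) (sym (ℕ→ℚ≡mkℚ n)))
  where
  numerator : + suc n ≡ + 1 ℤ.* + 1 ℤ.+ + n ℤ.* + 1
  numerator = cong (ℤ._+_ (+ 1)) (sym (ℤ.*-identityʳ (+ n)))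

sumFinℚ-const : ∀ n q → sumFinℚ n (λ _ → q) ≡ ℕ→ℚ n ℚ.* q
sumFinℚ-const zero q = sym (ℚ.*-zeroˡ q)
sumFinℚ-const (suc n) q = begin
  q ℚ.+ sumFinℚ n (λ _ → q)      ≡⟨ cong (q ℚ.+_) (sumFinℚ-const n q) ⟩
  q ℚ.+ ℕ→ℚ n ℚ.* q             ≡⟨ cong (ℚ._+ ℕ→ℚ n ℚ.* q) (ℚ.*-identityˡ q) ⟨
  1ℚ ℚ.* q ℚ.+ ℕ→ℚ n ℚ.* q      ≡⟨ ℚ.*-distribʳ-+ q 1ℚ (ℕ→ℚ n) ⟨
  (1ℚ ℚ.+ ℕ→ℚ n) ℚ.* q          ≡⟨ cong (ℚ._* q) (ℕ→ℚ-suc n) ⟨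
  ℕ→ℚ (suc n) ℚ.* q             ∎
  where open ≡-Reasoning

ℕ→ℚ*1/n≡1 : ∀ n .{{_ : NonZero n}} → ℕ→ℚ n ℚ.* (+ 1 / n) ≡ 1ℚ
ℕ→ℚ*1/n≡1 n@(suc _) = begin
  ℕ→ℚ n ℚ.* (+ 1 / n)          ≡⟨ cong₂ ℚ._*_ (ℕ→ℚ≡mkℚ n) (ℚ.normalize-coprime (1-coprimeTo n)) ⟩
  n′ ℚ.* 1/ n′                  ≡⟨ ℚ.*-inverseʳ n′ ⟩
  1ℚ                            ∎
  where
  open ≡-Reasoning
  n′ : ℚ
  n′ = mkℚ (+ n) 0 (coprime-sym (1-coprimeTo n))

theorem7p4 : (v : ℕ) .{{_ : NonZero v}} (m : ℕ) .{{_ : NonZero m}} (a : Fin m → ℕ) →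
    (∀ i → a i ∣ v) →
    (∀ i j → i ≢ j → a i ≢ a j) →
    (∀ i j → i ≢ j → lcm (a i) (a j) ≡ v) →
    IsVWOOC v m m (λ i → Xseq v (a i)) (λ i → v div a i) (λ i → v div a i) 1 (λ i → (+ 1) / m)
theorem7p4 v m a a∣v distinct lcm≡v = record
  { r-nonneg     = λ _ → ℚ.nonNegative⁻¹ _ {{ℚ.normalize-nonNeg 1 m}}
  ; r-sum        = trans (sumFinℚ-const m _) (ℕ→ℚ*1/n≡1 m)
  ; weight-count = λ i → trans (cong ℕ→ℚ (one-codeword-per-weight i)) 1≡1/m*m
  ; auto-bound   = λ j i w≡ δ _ _ → subst (_ ≤_) w≡ (corr≤weight v (Xseq v (a j)) (Xseq v (a j)) δ)
  ; cross-bound  = λ i j i≢j δ _ → corr-Xseq-≤1 (a∣v i) (a∣v j) (lcm≡v i j i≢j) δ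
  }
  where
  weight-determines-index : ∀ i j → weight (Xseq v (a j)) ≡ v div a i → j ≡ i
  weight-determines-index i j w≡ = decidable-stable (j Fin.≟ i) λ j≢i → distinct j i j≢i
    (div-injective (a∣v j) (a∣v i) (trans (sym (weight-Xseq (a∣v j))) w≡))
  one-codeword-per-weight : ∀ i → sumFin m (λ j → if weight (Xseq v (a j)) ≡ᵇ v div a i then 1 else 0) ≡ 1
  one-codeword-per-weight i =
    fibre-count m (weight ∘ Xseq v ∘ a) i (weight-Xseq (a∣v i)) (weight-determines-index i)
  1≡1/m*m : ℕ→ℚ 1 ≡ (+ 1 / m) ℚ.* ℕ→ℚ m
  1≡1/m*m = trans (sym (ℕ→ℚ*1/n≡1 m)) (ℚ.*-comm (ℕ→ℚ m) _)
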